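{- Let $\sigma\in A_n$ (the alternating group on a set $\phi=\{a_1,\dots,a_n\}$) be written as a product of $r$ disjoint cycles $\sigma=\tau_1\cdots\tau_r$, where $\tau_i$ is a $k_i$-cycle with $k_i\ge 2$ and $k_1+\cdots+k_r=n$. Let $x\notin\phi$ and let $S_{n+1}$ be the symmetric group on $\phi\cup\{x\}$. Then $\sigma^{ -1}$ can be written as a product of $\frac{n+r}{2}$ $3$-cycles of $S_{n+1}$, each of which moves $x$. Moreover, this is optimal: any expression of $\sigma^{ -1}$ as a product of $3$-cycles of $S_{n+1}$, each of which moves $x$, has at least $\frac{n+r}{2}$ factors.
   Context: Products of permutations are compositions, the rightmost factor applied first. -}

module Defs where

open import Data.Nat using (ℕ; suc)
open import Data.Fin using (Fin; zero; _≟_)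
open import Data.Fin.Permutation using (Permutation′; _⟨$⟩ʳ_)
open import Data.List using (List; []; _∷_; length)
open import Data.List.Relation.Unary.All using (All)
open import Data.Product using (Σ; ∃; _×_)
open import Data.Bool using (if_then_else_)
open import Relation.Nullary using (¬_; does)
open import Relation.Binary.PropositionalEquality using (_≡_; _≢_)

-- Evaluation of a product p₁ p₂ ⋯ pₖ of permutations at a point:
-- composition, the rightmost factor applied first.
prodApply : ∀ {m} → List (Permutation′ m) → Fin m → Fin m
prodApply []       y = y
prodApply (p ∷ ps) y = p ⟨$⟩ʳ prodApply ps y

IsTransposition : ∀ {m} → Permutation′ m → Set
IsTransposition {m} π = Σ (Fin m) λ a → Σ (Fin m) λ b →
  a ≢ b × π ⟨$⟩ʳ a ≡ b × π ⟨$⟩ʳ b ≡ a ×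
  (∀ y → y ≢ a → y ≢ b → π ⟨$⟩ʳ y ≡ y)

IsThreeCycle : ∀ {m} → Permutation′ m → Set
IsThreeCycle {m} π = Σ (Fin m) λ a → Σ (Fin m) λ b → Σ (Fin m) λ c →
  a ≢ b × b ≢ c × a ≢ c ×
  π ⟨$⟩ʳ a ≡ b × π ⟨$⟩ʳ b ≡ c × π ⟨$⟩ʳ c ≡ a ×
  (∀ y → y ≢ a → y ≢ b → y ≢ c → π ⟨$⟩ʳ y ≡ y)

Moves : ∀ {m} → Fin m → Permutation′ m → Set
Moves x π = π ⟨$⟩ʳ x ≢ x

-- Even permutation (element of the alternating group): a product of an
-- even number of transpositions.
data Even : ℕ → Set where
  ev0 : Even 0
  ev2 : ∀ {k} → Even k → Even (suc (suc k))

IsEven : ∀ {m} → Permutation′ m → Set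
IsEven {m} σ = Σ (List (Permutation′ m)) λ ts →
  All IsTransposition ts × Even (length ts) × (∀ y → σ ⟨$⟩ʳ y ≡ prodApply ts y)

-- The cycle (c₀ c₁ … c_{k-1}) given by a list: cᵢ ↦ cᵢ₊₁, c_{k-1} ↦ c₀,
-- all other points fixed.
private
  cyc : ∀ {m} → Fin m → List (Fin m) → Fin m → Fin m
  cyc f []           y = y
  cyc f (a ∷ [])     y = if does (y ≟ a) then f else y
  cyc f (a ∷ b ∷ cs) y = if does (y ≟ a) then b else cyc f (b ∷ cs) y

cycleFun : ∀ {m} → List (Fin m) → Fin m → Fin m
cycleFun []       y = y
cycleFun (a ∷ cs) y = cyc a (a ∷ cs) y

cyclesApply : ∀ {m} → List (List (Fin m)) → Fin m → Fin m
cyclesApply []       y = y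
cyclesApply (c ∷ cs) y = cycleFun c (cyclesApply cs y)

module Submission where

-- Let x = zero, so that φ is the image of suc in Fin (suc n).  For the star transpositions (x a),
-- the inverse of a k-cycle (c₁ … cₖ) is (x c₁)(x c₂)⋯(x cₖ)(x c₁), so σ⁻¹ is a product of n + r
-- stars.  That number is even: followed by an even transposition word for σ the stars multiply to
-- the identity, and such a word has even length because every transposition flips the parity of
-- the number of inversions.  Consecutive stars pair up into 3-cycles (x a)(x b) = (x b a).
--
-- Conversely, a 3-cycle moving x moves only two points of φ, so t such factors move points of φ at
-- most 2t times in total.  Each point of a cycle c of σ is moved at least once, and some point of
-- c twice: the rightmost factor touching c carries a point outside c onto some y ∈ c, and as σ⁻¹
-- maps c onto itself a later factor must move y again.  Summing |c| + 1 over the cycles gives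
-- n + r ≤ 2t.

open import Defs
open import Data.Nat using (ℕ; zero; suc; _+_; _*_; _∸_; _≤_; _<_; _<?_; s≤s; z≤n; parity)
open import Data.Nat.Properties
  using ( module ≤-Reasoning; +-assoc; +-comm; +-suc; *-suc; +-mono-≤; ≤-trans; ≤-reflexive; ≤-antisym
        ; ≤∧≢⇒<; ≤-pred; <⇒≤; <-irrefl; <-asym; <-trans; <⇒≢; <-cmp; n<1+n; m<n⇒m<1+n; m≤n⇒m≤1+n
        ; m≤n+m; m≤n⇒m≤o+n; m∸n+n≡m; n≢0⇒n>0; m+n≡0⇒m≡0; m+n≡0⇒n≡0 )
open import Data.Nat.Instances
open import Data.Nat.ListAction using (sum)
open import Data.Nat.ListAction.Properties using (sum-++)
open import Data.Nat.Solver using (module +-*-Solver)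
open import Data.Parity.Base using (0ℙ; 1ℙ; _⁻¹) renaming (_+_ to _⊕_)
open import Data.Parity.Properties
  using (suc-homo-⁻¹; ⁻¹-selfInverse; ⁻¹-involutive; +-cancelʳ-≡; +-homo-+; +-identityʳ)
open import Data.Fin as Fin using (Fin; zero; suc; toℕ; fromℕ<) renaming (_≟_ to _≟ᶠ_)
open import Data.Fin.Properties using (suc-injective; toℕ-injective; toℕ<n; toℕ-fromℕ<)
open import Data.Fin.Instances
open import Data.Fin.Permutation
  using (Permutation′; _⟨$⟩ʳ_; _⟨$⟩ˡ_; permutation; flip; lift₀; inverseʳ; inverseˡ)
open import Data.Fin.Permutation.Transposition.List using (TranspositionList) renaming (lift₀ to liftᵗ)
open import Data.List using (List; []; _∷_; _++_; _∷ʳ_; [_]; length; concat; map; allFin)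
open import Data.List.Properties using (map-++; map-∘; map-cong; map-id; length-++; length-map)
open import Data.List.Membership.Propositional using (_∈_; _∉_; find)
open import Data.List.Membership.Propositional.Properties
  using (∈-map⁺; ∈-map⁻; ∈-++⁺ˡ; ∈-++⁺ʳ; ∈-concat⁺′; ∈-allFin)
open import Data.List.Relation.Unary.Any as Any using (Any; here; there) renaming (tail to ∈-tail)
open import Data.List.Relation.Unary.All as All using (All; []; _∷_)
open import Data.List.Relation.Unary.All.Properties using (++⁺; ¬Any⇒All¬)
open import Data.List.Relation.Unary.Unique.Propositional using (Unique; []; _∷_; head)
open import Data.List.Relation.Unary.Unique.Propositional.Properties using (map⁺; allFin⁺)
open import Data.Product using (Σ; ∃-syntax; _×_; _,_; proj₁; proj₂)
open import Data.Sum as Sum using (_⊎_; inj₁; inj₂)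
open import Data.Bool using (if_then_else_)
open import Data.Empty using (⊥-elim)
open import Function using (_∘_; id; _⇔_; mk⇔)
open import Function.Properties.Equivalence using () renaming (sym to ⇔-sym)
open import Relation.Nullary using (¬_; Dec; yes; no; does; ¬?)
open import Relation.Nullary.Decidable using (does-⇔; dec-true; dec-false)
open import Relation.Unary using (Decidable)
open import Relation.Binary.Definitions using (tri<; tri≈; tri>)
open import Relation.Binary.Structures using (IsDecEquivalence)
open import Relation.Binary.TypeClasses using (_≟_)
open import Relation.Binary.PropositionalEquality
  using (_≡_; _≢_; refl; sym; trans; cong; cong₂; subst; subst₂; ≢-sym; module ≡-Reasoning)

open +-*-Solver using (solve; _:+_; _:=_; con)

-- Transpositions

module _ {ℓ} {A : Set ℓ} {{_ : IsDecEquivalence {A = A} _≡_}} where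
  open ≡-Reasoning

  swap : A → A → A → A
  swap a b x with x ≟ a
  ... | yes _ = b
  ... | no _ with x ≟ b
  ...   | yes _ = a
  ...   | no _ = x

  data SwapView (a b x : A) : A → Set ℓ where
    at-left   : x ≡ a → SwapView a b x b
    at-right  : x ≡ b → SwapView a b x a
    elsewhere : x ≢ a → x ≢ b → SwapView a b x x

  swap-view : ∀ a b x → SwapView a b x (swap a b x)
  swap-view a b x with x ≟ a
  ... | yes x≡a = at-left x≡a
  ... | no x≢a with x ≟ b
  ...   | yes x≡b = at-right x≡b
  ...   | no x≢b = elsewhere x≢a x≢b

  swap-left : ∀ a b → swap a b a ≡ b
  swap-left a b with swap a b a | swap-view a b a
  ... | _ | at-left _        = refl
  ... | _ | at-right refl    = refl
  ... | _ | elsewhere a≢a _  = ⊥-elim (a≢a refl)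

  swap-right : ∀ a b → swap a b b ≡ a
  swap-right a b with swap a b b | swap-view a b b
  ... | _ | at-left refl     = refl
  ... | _ | at-right _       = refl
  ... | _ | elsewhere _ b≢b  = ⊥-elim (b≢b refl)

  swap-other : ∀ {a b x} → x ≢ a → x ≢ b → swap a b x ≡ x
  swap-other {a} {b} {x} x≢a x≢b with swap a b x | swap-view a b x
  ... | _ | at-left x≡a      = ⊥-elim (x≢a x≡a)
  ... | _ | at-right x≡b     = ⊥-elim (x≢b x≡b)
  ... | _ | elsewhere _ _    = refl

  swap-involutive : ∀ a b x → swap a b (swap a b x) ≡ x
  swap-involutive a b x with swap a b x | swap-view a b x
  ... | _ | at-left refl     = swap-right a b
  ... | _ | at-right refl    = swap-left a b
  ... | _ | elsewhere x≢a x≢b = swap-other x≢a x≢b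

  swap-injective : ∀ a b {x y} → swap a b x ≡ swap a b y → x ≡ y
  swap-injective a b {x} {y} eq = begin
    x                       ≡⟨ swap-involutive a b x ⟨
    swap a b (swap a b x)   ≡⟨ cong (swap a b) eq ⟩
    swap a b (swap a b y)   ≡⟨ swap-involutive a b y ⟩
    y                       ∎

  swap-comm : ∀ a b x → swap a b x ≡ swap b a x
  swap-comm a b x with swap a b x | swap-view a b x
  ... | _ | at-left refl     = sym (swap-right b a)
  ... | _ | at-right refl    = sym (swap-left b a)
  ... | _ | elsewhere x≢a x≢b = sym (swap-other x≢b x≢a)

  swap-conjugate : ∀ {a b c} → a ≢ b → c ≢ a → c ≢ b →
                   ∀ x → swap a b x ≡ swap a c (swap c b (swap a c x))
  swap-conjugate {a} {b} {c} a≢b c≢a c≢b x = by-cases (x ≟ a) (x ≟ b) (x ≟ c)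
    where
    by-cases : Dec (x ≡ a) → Dec (x ≡ b) → Dec (x ≡ c) →
               swap a b x ≡ swap a c (swap c b (swap a c x))
    by-cases (yes refl) _ _ = begin
      swap x b x                     ≡⟨ swap-left x b ⟩
      b                              ≡⟨ swap-other (≢-sym a≢b) (≢-sym c≢b) ⟨
      swap x c b                     ≡⟨ cong (swap x c) (swap-left c b) ⟨
      swap x c (swap c b c)          ≡⟨ cong (λ y → swap x c (swap c b y)) (swap-left x c) ⟨
      swap x c (swap c b (swap x c x)) ∎
    by-cases (no _) (yes refl) _ = begin
      swap a x x
        ≡⟨ swap-right a x ⟩
      a
        ≡⟨ swap-right a c ⟨
      swap a c c
        ≡⟨ cong (swap a c) (swap-right c x) ⟨
      swap a c (swap c x x)
        ≡⟨ cong (λ y → swap a c (swap c x y)) (swap-other (≢-sym a≢b) (≢-sym c≢b)) ⟨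
      swap a c (swap c x (swap a c x)) ∎
    by-cases (no _) (no _) (yes refl) = begin
      swap a b x                     ≡⟨ swap-other c≢a c≢b ⟩
      x                              ≡⟨ swap-left a x ⟨
      swap a x a                     ≡⟨ cong (swap a x) (swap-other (≢-sym c≢a) a≢b) ⟨
      swap a x (swap x b a)          ≡⟨ cong (λ y → swap a x (swap x b y)) (swap-right a x) ⟨
      swap a x (swap x b (swap a x x)) ∎
    by-cases (no x≢a) (no x≢b) (no x≢c) = begin
      swap a b x                     ≡⟨ swap-other x≢a x≢b ⟩
      x                              ≡⟨ swap-other x≢a x≢c ⟨
      swap a c x                     ≡⟨ cong (swap a c) (swap-other x≢c x≢b) ⟨
      swap a c (swap c b x)          ≡⟨ cong (λ y → swap a c (swap c b y)) (swap-other x≢a x≢c) ⟨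
      swap a c (swap c b (swap a c x)) ∎

  swap-preserves : ∀ {p} (P : A → Set p) {a b x} → P a → P b → P x → P (swap a b x)
  swap-preserves P {a} {b} {x} Pa Pb Px with swap a b x | swap-view a b x
  ... | _ | at-left _       = Pb
  ... | _ | at-right _      = Pa
  ... | _ | elsewhere _ _   = Px

  swaps : List (A × A) → A → A
  swaps []             x = x
  swaps ((a , b) ∷ ps) x = swap a b (swaps ps x)

  swaps-++ : ∀ ps qs x → swaps (ps ++ qs) x ≡ swaps ps (swaps qs x)
  swaps-++ []             qs x = refl
  swaps-++ ((a , b) ∷ ps) qs x = cong (swap a b) (swaps-++ ps qs x)

  map-swap-involutive : ∀ a b xs → map (swap a b) (map (swap a b) xs) ≡ xs
  map-swap-involutive a b xs = begin
    map (swap a b) (map (swap a b) xs)  ≡⟨ map-∘ xs ⟨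
    map (swap a b ∘ swap a b) xs        ≡⟨ map-cong (swap-involutive a b) xs ⟩
    map id xs                           ≡⟨ map-id xs ⟩
    xs                                  ∎

swap-natural : ∀ {ℓ ℓ′} {A : Set ℓ} {B : Set ℓ′}
               {{_ : IsDecEquivalence {A = A} _≡_}} {{_ : IsDecEquivalence {A = B} _≡_}}
               {f : A → B} → (∀ {x y} → f x ≡ f y → x ≡ y) →
               ∀ a b x → f (swap a b x) ≡ swap (f a) (f b) (f x)
swap-natural {f = f} f-inj a b x with swap a b x | swap-view a b x
... | _ | at-left refl = sym (swap-left (f x) (f b))
... | _ | at-right refl = sym (swap-right (f a) (f x))
... | _ | elsewhere x≢a x≢b = sym (swap-other (x≢a ∘ f-inj) (x≢b ∘ f-inj))

-- Parity of inversions

countBelow : ℕ → List ℕ → ℕ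
countBelow x []       = 0
countBelow x (y ∷ ys) = (if does (y <? x) then 1 else 0) + countBelow x ys

inversions : List ℕ → ℕ
inversions []       = 0
inversions (x ∷ xs) = countBelow x xs + inversions xs

swapSuc : ℕ → ℕ → ℕ
swapSuc k = swap k (suc k)

Straddles : ℕ → ℕ → ℕ → Set
Straddles k x y = (x ≡ k × y ≡ suc k) ⊎ (x ≡ suc k × y ≡ k)

<-suc-⇔ : ∀ {y k} → y ≢ k → y < k ⇔ y < suc k
<-suc-⇔ y≢k = mk⇔ m<n⇒m<1+n (λ y<1+k → ≤∧≢⇒< (≤-pred y<1+k) y≢k)

suc-<-⇔ : ∀ {x k} → x ≢ suc k → suc k < x ⇔ k < x
suc-<-⇔ x≢1+k = mk⇔ <⇒≤ (λ k<x → ≤∧≢⇒< k<x (x≢1+k ∘ sym))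

swapSuc-<-⇔ : ∀ k {x y} → ¬ Straddles k x y → y < x ⇔ swapSuc k y < swapSuc k x
swapSuc-<-⇔ k {x} {y} ¬str
  with swapSuc k x | swap-view k (suc k) x | swapSuc k y | swap-view k (suc k) y
... | _ | at-left refl  | _ | at-left y≡k  = mk⇔ (⊥-elim ∘ <-irrefl y≡k) (⊥-elim ∘ <-irrefl refl)
... | _ | at-left refl  | _ | at-right refl = ⊥-elim (¬str (inj₁ (refl , refl)))
... | _ | at-left refl  | _ | elsewhere y≢k _ = <-suc-⇔ y≢k
... | _ | at-right refl | _ | at-left refl  = ⊥-elim (¬str (inj₂ (refl , refl)))
... | _ | at-right refl | _ | at-right y≡1+k = mk⇔ (⊥-elim ∘ <-irrefl y≡1+k) (⊥-elim ∘ <-irrefl refl)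
... | _ | at-right refl | _ | elsewhere y≢k _ = ⇔-sym (<-suc-⇔ y≢k)
... | _ | elsewhere _ x≢1+k | _ | at-left refl = ⇔-sym (suc-<-⇔ x≢1+k)
... | _ | elsewhere _ x≢1+k | _ | at-right refl = suc-<-⇔ x≢1+k
... | _ | elsewhere _ _ | _ | elsewhere _ _ = mk⇔ id id

indicator-cong : ∀ {P Q : Set} (p? : Dec P) (q? : Dec Q) → P ⇔ Q →
                 (if does p? then 1 else 0) ≡ (if does q? then 1 else 0)
indicator-cong p? q? P⇔Q = cong (λ b → if b then 1 else 0) (does-⇔ P⇔Q p? q?)

countBelow-swapSuc : ∀ k x ys → All (¬_ ∘ Straddles k x) ys →
                     countBelow (swapSuc k x) (map (swapSuc k) ys) ≡ countBelow x ys
countBelow-swapSuc k x []       []       = refl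
countBelow-swapSuc k x (y ∷ ys) (h ∷ hs) =
  cong₂ _+_ (indicator-cong (swapSuc k y <? swapSuc k x) (y <? x) (⇔-sym (swapSuc-<-⇔ k h)))
            (countBelow-swapSuc k x ys hs)

¬Straddles : ∀ {k x y xs} → k ∉ x ∷ xs ⊎ suc k ∉ x ∷ xs → y ∈ xs → ¬ Straddles k x y
¬Straddles (inj₁ k∉) y∈ (inj₁ (x≡k , _))   = k∉ (here (sym x≡k))
¬Straddles (inj₁ k∉) y∈ (inj₂ (_ , y≡k))   = k∉ (there (subst (_∈ _) y≡k y∈))
¬Straddles (inj₂ k∉) y∈ (inj₁ (_ , y≡1+k)) = k∉ (there (subst (_∈ _) y≡1+k y∈))
¬Straddles (inj₂ k∉) y∈ (inj₂ (x≡1+k , _)) = k∉ (here (sym x≡1+k))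

inversions-swapSuc-absent : ∀ k l → k ∉ l ⊎ suc k ∉ l → inversions (map (swapSuc k) l) ≡ inversions l
inversions-swapSuc-absent k []       _      = refl
inversions-swapSuc-absent k (x ∷ xs) absent =
  cong₂ _+_ (countBelow-swapSuc k x xs (All.tabulate (¬Straddles absent)))
            (inversions-swapSuc-absent k xs (Sum.map (_∘ there) (_∘ there) absent))

countBelow-suc-swapSuc : ∀ k ys → Unique ys → k ∉ ys → suc k ∈ ys →
                         countBelow (suc k) (map (swapSuc k) ys) ≡ suc (countBelow k ys)
countBelow-suc-swapSuc k (y ∷ ys) (y∉ys ∷ u) k∉ (here refl)
  rewrite swap-right k y | dec-true (k <? y) (n<1+n k) | dec-false (y <? k) (<-asym (n<1+n k)) =
  cong suc (begin
    countBelow y (map (swapSuc k) ys)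
      ≡⟨ cong (λ z → countBelow z (map (swapSuc k) ys)) (swap-left k y) ⟨
    countBelow (swapSuc k k) (map (swapSuc k) ys)
      ≡⟨ countBelow-swapSuc k k ys (All.tabulate ¬k-straddles) ⟩
    countBelow k ys ∎)
  where
  open ≡-Reasoning
  ¬k-straddles : ∀ {z} → z ∈ ys → ¬ Straddles k k z
  ¬k-straddles z∈ (inj₁ (_ , z≡y))     = All.lookup y∉ys z∈ (sym z≡y)
  ¬k-straddles z∈ (inj₂ (k≡1+k , _))  = <-irrefl k≡1+k (n<1+n k)
countBelow-suc-swapSuc k (y ∷ ys) (y∉ys ∷ u) k∉ (there 1+k∈) = begin
  (if does (swapSuc k y <? suc k) then 1 else 0) + countBelow (suc k) (map (swapSuc k) ys)
    ≡⟨ cong₂ _+_ (indicator-cong (swapSuc k y <? suc k) (y <? k) y<⇔)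
                 (countBelow-suc-swapSuc k ys u (k∉ ∘ there) 1+k∈) ⟩
  (if does (y <? k) then 1 else 0) + suc (countBelow k ys)
    ≡⟨ +-suc _ _ ⟩
  suc (countBelow k (y ∷ ys)) ∎
  where
  open ≡-Reasoning
  y≢k : y ≢ k
  y≢k y≡k = k∉ (here (sym y≡k))
  y≢1+k : y ≢ suc k
  y≢1+k y≡1+k = All.lookup y∉ys 1+k∈ y≡1+k
  y<⇔ : swapSuc k y < suc k ⇔ y < k
  y<⇔ rewrite swap-other y≢k y≢1+k = ⇔-sym (<-suc-⇔ y≢k)

countBelow-suc-unswap : ∀ k ys → Unique ys → suc k ∉ ys → k ∈ ys →
                        countBelow (suc k) ys ≡ suc (countBelow k (map (swapSuc k) ys))
countBelow-suc-unswap k ys u 1+k∉ k∈ = begin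
  countBelow (suc k) ys
    ≡⟨ cong (countBelow (suc k)) (map-swap-involutive k (suc k) ys) ⟨
  countBelow (suc k) (map (swapSuc k) ys′)
    ≡⟨ countBelow-suc-swapSuc k ys′ (map⁺ (swap-injective k (suc k)) u) k∉ys′ 1+k∈ys′ ⟩
  suc (countBelow k ys′) ∎
  where
  open ≡-Reasoning
  ys′ = map (swapSuc k) ys
  k∉ys′ : k ∉ ys′
  k∉ys′ k∈ys′ = 1+k∉ (subst₂ _∈_ (swap-left k (suc k)) (map-swap-involutive k (suc k) ys) (∈-map⁺ (swapSuc k) k∈ys′))
  1+k∈ys′ : suc k ∈ ys′
  1+k∈ys′ = subst (_∈ ys′) (swap-left k (suc k)) (∈-map⁺ (swapSuc k) k∈)

OneApart : ℕ → ℕ → Set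
OneApart m n = suc m ≡ n ⊎ suc n ≡ m

OneApart-+ˡ : ∀ c {m n} → OneApart m n → OneApart (c + m) (c + n)
OneApart-+ˡ c (inj₁ refl) = inj₁ (sym (+-suc c _))
OneApart-+ˡ c (inj₂ refl) = inj₂ (sym (+-suc c _))

inversions-swapSuc-present : ∀ k l → Unique l → k ∈ l → suc k ∈ l →
                             OneApart (inversions (map (swapSuc k) l)) (inversions l)
inversions-swapSuc-present k (x ∷ xs) (x∉xs ∷ u) k∈ 1+k∈ with swapSuc k x | swap-view k (suc k) x
... | _ | at-left refl =
  inj₂ (sym (cong₂ _+_ (countBelow-suc-swapSuc k xs u k∉xs (∈-tail (λ 1+k≡k → <-irrefl (sym 1+k≡k) (n<1+n k)) 1+k∈))
                       (inversions-swapSuc-absent k xs (inj₁ k∉xs))))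
  where
  k∉xs : k ∉ xs
  k∉xs k∈xs = All.lookup x∉xs k∈xs refl
... | _ | at-right refl =
  inj₁ (sym (cong₂ _+_ (countBelow-suc-unswap k xs u 1+k∉xs (∈-tail (λ k≡1+k → <-irrefl k≡1+k (n<1+n k)) k∈))
                       (sym (inversions-swapSuc-absent k xs (inj₂ 1+k∉xs)))))
  where
  1+k∉xs : suc k ∉ xs
  1+k∉xs 1+k∈xs = All.lookup x∉xs 1+k∈xs refl
... | _ | elsewhere x≢k x≢1+k =
  subst (λ b → OneApart (b + _) _) (sym countBelow-x)
        (OneApart-+ˡ (countBelow x xs)
          (inversions-swapSuc-present k xs u (∈-tail (x≢k ∘ sym) k∈) (∈-tail (x≢1+k ∘ sym) 1+k∈)))
  where
  countBelow-x : countBelow x (map (swapSuc k) xs) ≡ countBelow x xs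
  countBelow-x = trans (cong (λ z → countBelow z (map (swapSuc k) xs)) (sym (swap-other x≢k x≢1+k)))
                  (countBelow-swapSuc k x xs (All.tabulate (λ _ → Sum.[ x≢k ∘ proj₁ , x≢1+k ∘ proj₁ ])))

parity-suc : ∀ n → parity (suc n) ≡ parity n ⁻¹
parity-suc n = sym (⁻¹-selfInverse (suc-homo-⁻¹ n))

parity-OneApart : ∀ {m n} → OneApart m n → parity m ≡ parity n ⁻¹
parity-OneApart {m}     (inj₁ refl) = sym (suc-homo-⁻¹ m)
parity-OneApart {_} {n} (inj₂ refl) = parity-suc n

Covers : ℕ → List ℕ → Set
Covers m l = ∀ {v} → v < m → v ∈ l

Covers-swap : ∀ {m a b l} → a < m → b < m → Covers m l → Covers m (map (swap a b) l)
Covers-swap {m} {a} {b} {l} a<m b<m covers {v} v<m =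
  subst (_∈ map (swap a b) l) (swap-involutive a b v)
        (∈-map⁺ (swap a b) (covers (swap-preserves (_< m) a<m b<m v<m)))

private
  inversions-swap-distance : ∀ d a b {m l} → b ≡ suc (d + a) → b < m → Unique l → Covers m l →
                             parity (inversions (map (swap a b) l)) ≡ parity (inversions l) ⁻¹
  inversions-swap-distance zero a _ refl 1+a<m u covers =
    parity-OneApart (inversions-swapSuc-present a _ u (covers (<-trans (n<1+n a) 1+a<m)) (covers 1+a<m))
  inversions-swap-distance (suc d) a b {m} {l} refl b<m u covers = begin
    parity (inversions (map (swap a b) l))
      ≡⟨ cong (parity ∘ inversions) conjugate ⟩
    parity (inversions (map (swapSuc a) l₂))
      ≡⟨ parity-OneApart (inversions-swapSuc-present a l₂ u₂ (covers₂ a<m) (covers₂ 1+a<m)) ⟩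
    parity (inversions l₂) ⁻¹
      ≡⟨ cong _⁻¹ (inversions-swap-distance d (suc a) b (cong suc (sym (+-suc d a))) b<m u₁ covers₁) ⟩
    parity (inversions l₁) ⁻¹ ⁻¹
      ≡⟨ ⁻¹-involutive _ ⟩
    parity (inversions l₁)
      ≡⟨ parity-OneApart (inversions-swapSuc-present a l u (covers a<m) (covers 1+a<m)) ⟩
    parity (inversions l) ⁻¹ ∎
    where
    open ≡-Reasoning
    1+a<b : suc a < b
    1+a<b = s≤s (s≤s (m≤n+m a d))
    1+a<m = <-trans 1+a<b b<m
    a<m = <-trans (n<1+n a) 1+a<m
    l₁ = map (swapSuc a) l
    l₂ = map (swap (suc a) b) l₁
    u₁ = map⁺ (swap-injective a (suc a)) u
    u₂ = map⁺ (swap-injective (suc a) b) u₁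
    covers₁ = Covers-swap a<m 1+a<m covers
    covers₂ = Covers-swap 1+a<m b<m covers₁
    conjugate : map (swap a b) l ≡ map (swapSuc a) l₂
    conjugate = begin
      map (swap a b) l
        ≡⟨ map-cong (swap-conjugate (<⇒≢ (<-trans (n<1+n a) 1+a<b)) (≢-sym (<⇒≢ (n<1+n a))) (<⇒≢ 1+a<b)) l ⟩
      map (swapSuc a ∘ swap (suc a) b ∘ swapSuc a) l
        ≡⟨ map-∘ l ⟩
      map (swapSuc a) (map (swap (suc a) b ∘ swapSuc a) l)
        ≡⟨ cong (map (swapSuc a)) (map-∘ l) ⟩
      map (swapSuc a) l₂ ∎

inversions-swap : ∀ {m a b l} → a < m → b < m → a ≢ b → Unique l → Covers m l →
                  parity (inversions (map (swap a b) l)) ≡ parity (inversions l) ⁻¹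
inversions-swap {a = a} {b} {l} a<m b<m a≢b u covers with <-cmp a b
... | tri< a<b _ _ =
  inversions-swap-distance (b ∸ suc a) a b (sym (trans (sym (+-suc _ a)) (m∸n+n≡m a<b))) b<m u covers
... | tri≈ _ a≡b _ = ⊥-elim (a≢b a≡b)
... | tri> _ _ b<a =
  trans (cong (parity ∘ inversions) (map-cong (swap-comm a b) l))
        (inversions-swap-distance (a ∸ suc b) b a (sym (trans (sym (+-suc _ b)) (m∸n+n≡m b<a))) a<m u covers)

oneLine : ∀ {m} → (Fin m → Fin m) → List ℕ
oneLine {m} f = map (toℕ ∘ f) (allFin m)

oneLine-swap : ∀ {m} (a b : Fin m) f → oneLine (swap a b ∘ f) ≡ map (swap (toℕ a) (toℕ b)) (oneLine f)
oneLine-swap {m} a b f = trans (map-cong (swap-natural toℕ-injective a b ∘ f) (allFin m)) (map-∘ (allFin m))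

Unique-oneLine-swaps : ∀ {m} (ps : List (Fin m × Fin m)) → Unique (oneLine (swaps ps))
Unique-oneLine-swaps {m} []             = map⁺ toℕ-injective (allFin⁺ m)
Unique-oneLine-swaps     ((a , b) ∷ ps) =
  subst Unique (sym (oneLine-swap a b (swaps ps))) (map⁺ (swap-injective _ _) (Unique-oneLine-swaps ps))

Covers-oneLine-swaps : ∀ {m} (ps : List (Fin m × Fin m)) → Covers m (oneLine (swaps ps))
Covers-oneLine-swaps {m} [] v<m = subst (_∈ _) (toℕ-fromℕ< v<m) (∈-map⁺ toℕ (∈-allFin (fromℕ< v<m)))
Covers-oneLine-swaps ((a , b) ∷ ps) =
  subst (Covers _) (sym (oneLine-swap a b (swaps ps))) (Covers-swap (toℕ<n a) (toℕ<n b) (Covers-oneLine-swaps ps))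

Distinct : ∀ {ℓ} {A : Set ℓ} → A × A → Set ℓ
Distinct (a , b) = a ≢ b

private
  ⁻¹-⊕ : ∀ p q → (p ⊕ q) ⁻¹ ≡ p ⁻¹ ⊕ q
  ⁻¹-⊕ 0ℙ q = refl
  ⁻¹-⊕ 1ℙ q = ⁻¹-involutive q

parity-inversions-swaps : ∀ {m} (ps : List (Fin m × Fin m)) → All Distinct ps →
  parity (inversions (oneLine (swaps ps))) ≡ parity (length ps) ⊕ parity (inversions (oneLine {m} id))
parity-inversions-swaps []             []          = refl
parity-inversions-swaps {m} ((a , b) ∷ ps) (a≢b ∷ ds) = begin
  parity (inversions (oneLine (swap a b ∘ swaps ps)))
   
     ≡⟨ cong (parity ∘ inversions) (oneLine-swap a b (swaps ps)) ⟩
  parity (inversions (map (swap (toℕ a) (toℕ b)) (oneLine (swaps ps))))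
   
     ≡⟨ inversions-swap (toℕ<n a) (toℕ<n b) (a≢b ∘ toℕ-injective) (Unique-oneLine-swaps ps) (Covers-oneLine-swaps ps) ⟩
  parity (inversions (oneLine (swaps ps))) ⁻¹
   
     ≡⟨ cong _⁻¹ (parity-inversions-swaps ps ds) ⟩
  (parity (length ps) ⊕ parity (inversions (oneLine {m} id))) ⁻¹
   
     ≡⟨ ⁻¹-⊕ (parity (length ps)) _ ⟩
  parity (length ps) ⁻¹ ⊕ parity (inversions (oneLine {m} id))
   
     ≡⟨ cong (_⊕ _) (parity-suc (length ps)) ⟨
  parity (suc (length ps)) ⊕ parity (inversions (oneLine {m} id))
    ∎
  where open ≡-Reasoning

swaps≗id⇒even : ∀ {m} (ps : List (Fin m × Fin m)) → All Distinct ps → (∀ x → swaps ps x ≡ x) →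
                parity (length ps) ≡ 0ℙ
swaps≗id⇒even {m} ps ds ps≗id = +-cancelʳ-≡ _ (parity (length ps)) 0ℙ (begin
  parity (length ps) ⊕ parity (inversions (oneLine {m} id))
    ≡⟨ parity-inversions-swaps ps ds ⟨
  parity (inversions (oneLine (swaps ps)))
    ≡⟨ cong (parity ∘ inversions) (map-cong (cong toℕ ∘ ps≗id) (allFin _)) ⟩
  parity (inversions (oneLine {m} id)) ∎)
  where open ≡-Reasoning

-- Cycles

if-yes : ∀ {a p} {A : Set a} {P : Set p} (p? : Dec P) {x y : A} → P → (if does p? then x else y) ≡ x
if-yes p? p = cong (λ b → if b then _ else _) (dec-true p? p)

if-no : ∀ {a p} {A : Set a} {P : Set p} (p? : Dec P) {x y : A} → ¬ P → (if does p? then x else y) ≡ y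
if-no p? ¬p = cong (λ b → if b then _ else _) (dec-false p? ¬p)

unique-++⁻ : ∀ {a} {A : Set a} (xs : List A) {ys} → Unique (xs ++ ys) →
             Unique xs × Unique ys × (∀ {v} → v ∈ xs → v ∉ ys)
unique-++⁻ []       u = [] , u , λ ()
unique-++⁻ (x ∷ xs) (x∉ ∷ u) with unique-++⁻ xs u
... | uxs , uys , disjoint = All.tabulate (λ v∈ → All.lookup x∉ (∈-++⁺ˡ v∈)) ∷ uxs , uys , disjoint′
  where
  disjoint′ : ∀ {v} → v ∈ x ∷ xs → v ∉ _
  disjoint′ (here refl) v∈ys = All.lookup x∉ (∈-++⁺ʳ xs v∈ys) refl
  disjoint′ (there v∈xs)    = disjoint v∈xs

unique-∈-concat : ∀ {a} {A : Set a} (xss : List (List A)) → Unique (concat xss) → ∀ {xs} → xs ∈ xss → Unique xs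
unique-∈-concat (xs ∷ xss) u (here refl) = proj₁ (unique-++⁻ xs u)
unique-∈-concat (xs ∷ xss) u (there xs∈) = unique-∈-concat xss (proj₁ (proj₂ (unique-++⁻ xs u))) xs∈

-- A copy of the private helper of cycleFun in Defs: aᵢ ↦ aᵢ₊₁ along a₁ … aₖ, and aₖ ↦ f.
chainTo : ∀ {m} → Fin m → List (Fin m) → Fin m → Fin m
chainTo f []           y = y
chainTo f (a ∷ [])     y = if does (y ≟ᶠ a) then f else y
chainTo f (a ∷ b ∷ cs) y = if does (y ≟ᶠ a) then b else chainTo f (b ∷ cs) y

module _ {m : ℕ} where

  cycleFun-∷ : ∀ (f : Fin m) cs {y} → y ≢ f → cycleFun (f ∷ cs) y ≡ chainTo f cs y
  cycleFun-∷ f []           y≢f = if-no (_ ≟ᶠ f) y≢f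
  cycleFun-∷ f (a ∷ [])     y≢f = if-no (_ ≟ᶠ f) y≢f
  cycleFun-∷ f (a ∷ b ∷ cs) {y} y≢f =
    trans (if-no (y ≟ᶠ f) y≢f)
          (cong (λ z → if does (y ≟ᶠ a) then b else z)
                (trans (sym (if-no (y ≟ᶠ f) y≢f)) (cycleFun-∷ f (b ∷ cs) y≢f)))

  cycleFun-head : ∀ (f a : Fin m) cs → cycleFun (f ∷ a ∷ cs) f ≡ a
  cycleFun-head f a cs = if-yes (f ≟ᶠ f) refl

  chainTo-∉ : ∀ (f : Fin m) cs {z} → z ∉ cs → chainTo f cs z ≡ z
  chainTo-∉ f []           z∉ = refl
  chainTo-∉ f (a ∷ [])     z∉ = if-no (_ ≟ᶠ a) (z∉ ∘ here)
  chainTo-∉ f (a ∷ b ∷ cs) z∉ = trans (if-no (_ ≟ᶠ a) (z∉ ∘ here)) (chainTo-∉ f (b ∷ cs) (z∉ ∘ there))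

  chainTo-∈ : ∀ (f : Fin m) a cs {z} → Unique (a ∷ cs) → f ∉ a ∷ cs → z ∈ a ∷ cs →
              chainTo f (a ∷ cs) z ∈ f ∷ a ∷ cs × chainTo f (a ∷ cs) z ≢ z
  chainTo-∈ f a []       u f∉ (here refl) rewrite if-yes (a ≟ᶠ a) {f} {a} refl = here refl , f∉ ∘ here
  chainTo-∈ f a (b ∷ cs) (a∉ ∷ u) f∉ (here refl)
    rewrite if-yes (a ≟ᶠ a) {b} {chainTo f (b ∷ cs) a} refl =
    there (there (here refl)) , All.lookup a∉ (here refl) ∘ sym
  chainTo-∈ f a (b ∷ cs) {z} (a∉ ∷ u) f∉ (there z∈)
    rewrite if-no (z ≟ᶠ a) {b} {chainTo f (b ∷ cs) z} (λ { refl → All.lookup a∉ z∈ refl })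
    with chainTo-∈ f b cs u (f∉ ∘ there) z∈
  ... | here e    , moved = here e , moved
  ... | there fz∈ , moved = there (there fz∈) , moved

  cycleFun-∉ : ∀ (c : List (Fin m)) {z} → z ∉ c → cycleFun c z ≡ z
  cycleFun-∉ []      z∉ = refl
  cycleFun-∉ (f ∷ c) z∉ = trans (cycleFun-∷ f c (z∉ ∘ here)) (chainTo-∉ f c (z∉ ∘ there))

  cycleFun-∈ : ∀ (c : List (Fin m)) → 2 ≤ length c → Unique c → ∀ {y} → y ∈ c →
               cycleFun c y ∈ c × cycleFun c y ≢ y
  cycleFun-∈ (f ∷ a ∷ cs) _ (f∉ ∷ u) (here refl) rewrite cycleFun-head f a cs =
    there (here refl) , All.lookup f∉ (here refl) ∘ sym
  cycleFun-∈ (f ∷ a ∷ cs) _ (f∉ ∷ u) (there y∈) rewrite cycleFun-∷ f (a ∷ cs) (All.lookup f∉ y∈ ∘ sym) =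
    chainTo-∈ f a cs u (λ f∈ → All.lookup f∉ f∈ refl) y∈
  cycleFun-∈ (_ ∷ []) (s≤s ()) _ _

  cyclesApply-∉ : ∀ (cs : List (List (Fin m))) {z} → z ∉ concat cs → cyclesApply cs z ≡ z
  cyclesApply-∉ []       z∉ = refl
  cyclesApply-∉ (c ∷ cs) z∉ =
    trans (cong (cycleFun c) (cyclesApply-∉ cs (z∉ ∘ ∈-++⁺ʳ c))) (cycleFun-∉ c (z∉ ∘ ∈-++⁺ˡ))

  cyclesApply-∈ : ∀ (cs : List (List (Fin m))) → All (λ c → 2 ≤ length c) cs → Unique (concat cs) →
                  ∀ {c} → c ∈ cs → ∀ {y} → y ∈ c → cyclesApply cs y ≡ cycleFun c y
  cyclesApply-∈ (c ∷ cs) _ u (here refl) y∈ =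
    cong (cycleFun c) (cyclesApply-∉ cs (proj₂ (proj₂ (unique-++⁻ c u)) y∈))
  cyclesApply-∈ (c′ ∷ cs) (_ ∷ lengths) u (there c∈) {y} y∈ with unique-++⁻ c′ u
  ... | _ , u-cs , disjoint =
    trans (cong (cycleFun c′) (cyclesApply-∈ cs lengths u-cs c∈ y∈))
          (cycleFun-∉ c′ (λ σy∈c′ → disjoint σy∈c′ (∈-concat⁺′ σy∈c c∈)))
    where
    σy∈c = proj₁ (cycleFun-∈ _ (All.lookup lengths c∈) (unique-∈-concat cs u-cs c∈) y∈)

-- Star transpositions

module _ {n : ℕ} where

  starPairs : List (Fin n) → List (Fin (suc n) × Fin (suc n))
  starPairs = map (λ a → zero , suc a)

  star : Fin n → Fin (suc n) → Fin (suc n)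
  star a = swap zero (suc a)

  stars : List (Fin n) → Fin (suc n) → Fin (suc n)
  stars = swaps ∘ starPairs

  star-zero : ∀ a → star a zero ≡ suc a
  star-zero a = swap-left zero (suc a)

  star-self : ∀ a → star a (suc a) ≡ zero
  star-self a = swap-right zero (suc a)

  star-other : ∀ {a v} → v ≢ a → star a (suc v) ≡ suc v
  star-other {a} v≢a = swap-other {a = zero} {b = suc a} (λ ()) (v≢a ∘ suc-injective)

  stars-++ : ∀ as bs y → stars (as ++ bs) y ≡ stars as (stars bs y)
  stars-++ as bs y = trans (cong (λ ps → swaps ps y) (map-++ _ as bs)) (swaps-++ (starPairs as) (starPairs bs) y)

  stars-other : ∀ as {v} → v ∉ as → stars as (suc v) ≡ suc v
  stars-other []       v∉ = refl
  stars-other (a ∷ as) v∉ = trans (cong (star a) (stars-other as (v∉ ∘ there))) (star-other (v∉ ∘ here))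

  stars-self : ∀ a as → a ∉ as → stars (a ∷ as) (suc a) ≡ zero
  stars-self a as a∉ = trans (cong (star a) (stars-other as a∉)) (star-self a)

  stars-chainTo : ∀ f a as {z} → Unique (a ∷ as) → f ∉ a ∷ as → z ≢ f →
                  stars (a ∷ as) (star f (suc (chainTo f (a ∷ as) z))) ≡ suc z
  stars-chainTo f a [] {z} _ f∉ z≢f with z ≟ᶠ a
  ... | yes refl = trans (cong (star z) (star-self f)) (star-zero z)
  ... | no z≢a   = trans (cong (star a) (star-other z≢f)) (star-other z≢a)
  stars-chainTo f a (b ∷ bs) {z} (_ ∷ u) f∉ z≢f with z ≟ᶠ a
  ... | yes refl = begin
    star z (stars (b ∷ bs) (star f (suc b)))
      ≡⟨ cong (star z ∘ stars (b ∷ bs)) (star-other (f∉ ∘ there ∘ here ∘ sym)) ⟩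
    star z (stars (b ∷ bs) (suc b))
      ≡⟨ cong (star z) (stars-self b bs (λ b∈ → All.lookup (head u) b∈ refl)) ⟩
    star z zero
      ≡⟨ star-zero z ⟩
    suc z ∎
    where open ≡-Reasoning
  ... | no z≢a = trans (cong (star a) (stars-chainTo f b bs u (f∉ ∘ there) z≢f)) (star-other z≢a)

  -- (x c₁)(x c₂)⋯(x cₖ)(x c₁) is the inverse of the cycle (c₁ … cₖ) and fixes x = zero.
  cycleWord : List (Fin n) → List (Fin n)
  cycleWord []      = []
  cycleWord (a ∷ c) = a ∷ c ∷ʳ a

  stars-cycleWord : ∀ c → 2 ≤ length c → Unique c → ∀ z → stars (cycleWord c) (suc (cycleFun c z)) ≡ suc z
  stars-cycleWord (f ∷ a ∷ c) _ (f∉ ∷ u) z = by-cases (z ≟ᶠ f)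
    where
    open ≡-Reasoning
    by-cases : Dec (z ≡ f) → stars (cycleWord (f ∷ a ∷ c)) (suc (cycleFun (f ∷ a ∷ c) z)) ≡ suc z
    by-cases (yes refl) = begin
      stars (z ∷ a ∷ c ∷ʳ z) (suc (cycleFun (z ∷ a ∷ c) z))
        ≡⟨ cong (stars (z ∷ a ∷ c ∷ʳ z) ∘ suc) (cycleFun-head z a c) ⟩
      stars (z ∷ a ∷ c ∷ʳ z) (suc a)
        ≡⟨ stars-++ (z ∷ a ∷ c) [ z ] (suc a) ⟩
      star z (stars (a ∷ c) (star z (suc a)))
        ≡⟨ cong (star z ∘ stars (a ∷ c)) (star-other (All.lookup f∉ (here refl) ∘ sym)) ⟩
      star z (stars (a ∷ c) (suc a))
        ≡⟨ cong (star z) (stars-self a c (λ a∈ → All.lookup (head u) a∈ refl)) ⟩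
      star z zero
        ≡⟨ star-zero z ⟩
      suc z ∎
    by-cases (no z≢f) = begin
      stars (f ∷ a ∷ c ∷ʳ f) (suc (cycleFun (f ∷ a ∷ c) z))
        ≡⟨ cong (stars (f ∷ a ∷ c ∷ʳ f) ∘ suc) (cycleFun-∷ f (a ∷ c) z≢f) ⟩
      stars (f ∷ a ∷ c ∷ʳ f) (suc (chainTo f (a ∷ c) z))
        ≡⟨ stars-++ (f ∷ a ∷ c) [ f ] _ ⟩
      star f (stars (a ∷ c) (star f (suc (chainTo f (a ∷ c) z))))
        ≡⟨ cong (star f) (stars-chainTo f a c u (λ f∈ → All.lookup f∉ f∈ refl) z≢f) ⟩
      star f (suc z)
        ≡⟨ star-other z≢f ⟩
      suc z ∎

  stars-cycleWord (_ ∷ []) (s≤s ()) _ _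

  stars-cycleWord-zero : ∀ c → Unique c → stars (cycleWord c) zero ≡ zero
  stars-cycleWord-zero []      _        = refl
  stars-cycleWord-zero (f ∷ c) (f∉ ∷ _) = begin
    stars (f ∷ c ∷ʳ f) zero        ≡⟨ stars-++ (f ∷ c) [ f ] zero ⟩
    stars (f ∷ c) (star f zero)    ≡⟨ cong (stars (f ∷ c)) (star-zero f) ⟩
    stars (f ∷ c) (suc f)          ≡⟨ stars-self f c (λ f∈ → All.lookup f∉ f∈ refl) ⟩
    zero                           ∎
    where open ≡-Reasoning

  length-cycleWord : ∀ c → 2 ≤ length c → length (cycleWord c) ≡ suc (length c)
  length-cycleWord (f ∷ c) _ = cong suc (trans (length-++ c) (+-comm (length c) 1))

  cyclesWord : List (List (Fin n)) → List (Fin n)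
  cyclesWord []       = []
  cyclesWord (c ∷ cs) = cyclesWord cs ++ cycleWord c

  stars-cyclesWord : ∀ cs → All (λ c → 2 ≤ length c) cs → Unique (concat cs) →
                     ∀ z → stars (cyclesWord cs) (suc (cyclesApply cs z)) ≡ suc z
  stars-cyclesWord []       _                 _ z = refl
  stars-cyclesWord (c ∷ cs) (2≤∣c∣ ∷ lengths) u z with unique-++⁻ c u
  ... | u-c , u-cs , _ = begin
    stars (cyclesWord cs ++ cycleWord c) (suc (cycleFun c (cyclesApply cs z)))
      ≡⟨ stars-++ (cyclesWord cs) (cycleWord c) _ ⟩
    stars (cyclesWord cs) (stars (cycleWord c) (suc (cycleFun c (cyclesApply cs z))))
      ≡⟨ cong (stars (cyclesWord cs)) (stars-cycleWord c 2≤∣c∣ u-c _) ⟩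
    stars (cyclesWord cs) (suc (cyclesApply cs z))
      ≡⟨ stars-cyclesWord cs lengths u-cs z ⟩
    suc z ∎
    where open ≡-Reasoning

  stars-cyclesWord-zero : ∀ cs → Unique (concat cs) → stars (cyclesWord cs) zero ≡ zero
  stars-cyclesWord-zero []       _ = refl
  stars-cyclesWord-zero (c ∷ cs) u with unique-++⁻ c u
  ... | u-c , u-cs , _ =
    trans (stars-++ (cyclesWord cs) (cycleWord c) zero)
          (trans (cong (stars (cyclesWord cs)) (stars-cycleWord-zero c u-c)) (stars-cyclesWord-zero cs u-cs))

  length-cyclesWord : ∀ cs → All (λ c → 2 ≤ length c) cs → length (cyclesWord cs) ≡ sum (map length cs) + length cs
  length-cyclesWord []       _                 = refl
  length-cyclesWord (c ∷ cs) (2≤∣c∣ ∷ lengths) = begin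
    length (cyclesWord cs ++ cycleWord c)
      ≡⟨ length-++ (cyclesWord cs) ⟩
    length (cyclesWord cs) + length (cycleWord c)
      ≡⟨ cong₂ _+_ (length-cyclesWord cs lengths) (length-cycleWord c 2≤∣c∣) ⟩
    (sum (map length cs) + length cs) + suc (length c)
      ≡⟨ solve 3 (λ s r k → (s :+ r) :+ (con 1 :+ k) := (k :+ s) :+ (con 1 :+ r)) refl
                 (sum (map length cs)) (length cs) (length c) ⟩
    (length c + sum (map length cs)) + suc (length cs) ∎
    where open ≡-Reasoning

stars-cyclesWord-σ⁻¹ : ∀ {n} {σ : Permutation′ n} (cs : List (List (Fin n))) → All (λ c → 2 ≤ length c) cs →
                       Unique (concat cs) → (∀ y → σ ⟨$⟩ʳ y ≡ cyclesApply cs y) →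
                       ∀ y → stars (cyclesWord cs) y ≡ lift₀ (flip σ) ⟨$⟩ʳ y
stars-cyclesWord-σ⁻¹         cs lengths u σ≗cs zero    = stars-cyclesWord-zero cs u
stars-cyclesWord-σ⁻¹ {σ = σ} cs lengths u σ≗cs (suc y) = begin
  stars (cyclesWord cs) (suc y)
    ≡⟨ cong (stars (cyclesWord cs) ∘ suc) (inverseʳ σ) ⟨
  stars (cyclesWord cs) (suc (σ ⟨$⟩ʳ (σ ⟨$⟩ˡ y)))
    ≡⟨ cong (stars (cyclesWord cs) ∘ suc) (σ≗cs (σ ⟨$⟩ˡ y)) ⟩
  stars (cyclesWord cs) (suc (cyclesApply cs (σ ⟨$⟩ˡ y)))
    ≡⟨ stars-cyclesWord cs lengths u (σ ⟨$⟩ˡ y) ⟩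
  suc (σ ⟨$⟩ˡ y) ∎
  where open ≡-Reasoning

parity-Even : ∀ {k} → Even k → parity k ≡ 0ℙ
parity-Even ev0      = refl
parity-Even (ev2 ev) = parity-Even ev

module _ {m : ℕ} where

  transpositionPairs : {ts : List (Permutation′ m)} → All IsTransposition ts → TranspositionList m
  transpositionPairs []                  = []
  transpositionPairs ((a , b , _) ∷ ts) = (a , b) ∷ transpositionPairs ts

  transposition-swap : ∀ {π : Permutation′ m} ((a , b , _) : IsTransposition π) → ∀ y → π ⟨$⟩ʳ y ≡ swap a b y
  transposition-swap (a , b , _ , πa≡b , πb≡a , rest) y with swap a b y | swap-view a b y
  ... | _ | at-left refl        = πa≡b
  ... | _ | at-right refl       = πb≡a
  ... | _ | elsewhere y≢a y≢b   = rest y y≢a y≢b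

  prodApply-transpositions : ∀ {ts : List (Permutation′ m)} (τs : All IsTransposition ts) →
                             ∀ y → prodApply ts y ≡ swaps (transpositionPairs τs) y
  prodApply-transpositions []                                  y = refl
  prodApply-transpositions {t ∷ ts} (τ@(a , b , _) ∷ τs) y =
    trans (transposition-swap {t} τ (prodApply ts y)) (cong (swap a b) (prodApply-transpositions τs y))

  transpositionPairs-distinct : ∀ {ts : List (Permutation′ m)} (τs : All IsTransposition ts) →
                                All Distinct (transpositionPairs τs)
  transpositionPairs-distinct []                    = []
  transpositionPairs-distinct ((_ , _ , a≢b , _) ∷ τs) = a≢b ∷ transpositionPairs-distinct τs

  length-transpositionPairs : ∀ {ts : List (Permutation′ m)} (τs : All IsTransposition ts) →
                              length (transpositionPairs τs) ≡ length ts
  length-transpositionPairs []       = refl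
  length-transpositionPairs (_ ∷ τs) = cong suc (length-transpositionPairs τs)

  swaps-lift-suc : ∀ (ps : TranspositionList m) y → swaps (liftᵗ ps) (suc y) ≡ suc (swaps ps y)
  swaps-lift-suc []             y = refl
  swaps-lift-suc ((a , b) ∷ ps) y =
    trans (cong (swap (suc a) (suc b)) (swaps-lift-suc ps y)) (sym (swap-natural suc-injective a b (swaps ps y)))

  swaps-lift-zero : ∀ (ps : TranspositionList m) → swaps (liftᵗ ps) zero ≡ zero
  swaps-lift-zero []             = refl
  swaps-lift-zero ((a , b) ∷ ps) =
    trans (cong (swap (suc a) (suc b)) (swaps-lift-zero ps)) (swap-other {a = suc a} {b = suc b} (λ ()) (λ ()))

  lift-distinct : ∀ {ps : TranspositionList m} → All Distinct ps → All Distinct (liftᵗ ps)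
  lift-distinct []          = []
  lift-distinct (a≢b ∷ ds) = (a≢b ∘ suc-injective) ∷ lift-distinct ds

starPairs-distinct : ∀ {n} (as : List (Fin n)) → All Distinct (starPairs as)
starPairs-distinct []       = []
starPairs-distinct (_ ∷ as) = (λ ()) ∷ starPairs-distinct as

-- The star word of σ⁻¹ followed by the transpositions of σ multiplies to the identity.
parity-cyclesWord : ∀ {n} {σ : Permutation′ n} → IsEven σ → (cs : List (List (Fin n))) →
                    All (λ c → 2 ≤ length c) cs → Unique (concat cs) → (∀ y → σ ⟨$⟩ʳ y ≡ cyclesApply cs y) →
                    parity (length (cyclesWord cs)) ≡ 0ℙ
parity-cyclesWord {σ = σ} (ts , τs , even , σ≗ts) cs lengths u σ≗cs = begin
  parity W
    ≡⟨ +-identityʳ (parity W) ⟨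
  parity W ⊕ 0ℙ
    ≡⟨ cong (parity W ⊕_) (parity-Even even) ⟨
  parity W ⊕ parity (length ts)
    ≡⟨ +-homo-+ W (length ts) ⟨
  parity (W + length ts)
    ≡⟨ cong parity length-ps ⟨
  parity (length ps)
    ≡⟨ swaps≗id⇒even ps (++⁺ (starPairs-distinct (cyclesWord cs)) (lift-distinct (transpositionPairs-distinct τs))) ps≗id ⟩
  0ℙ ∎
  where
  open ≡-Reasoning
  W  = length (cyclesWord cs)
  T  = transpositionPairs τs
  ps = starPairs (cyclesWord cs) ++ liftᵗ T
  length-ps : length ps ≡ W + length ts
  length-ps = trans (length-++ (starPairs (cyclesWord cs)))
                    (cong₂ _+_ (length-map _ (cyclesWord cs)) (trans (length-map _ T) (length-transpositionPairs τs)))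
  ps≗id : ∀ x → swaps ps x ≡ x
  ps≗id zero = begin
    swaps ps zero                           ≡⟨ swaps-++ (starPairs (cyclesWord cs)) (liftᵗ T) zero ⟩
    stars (cyclesWord cs) (swaps (liftᵗ T) zero) ≡⟨ cong (stars (cyclesWord cs)) (swaps-lift-zero T) ⟩
    stars (cyclesWord cs) zero              ≡⟨ stars-cyclesWord-zero cs u ⟩
    zero                                    ∎
  ps≗id (suc i) = begin
    swaps ps (suc i)                             ≡⟨ swaps-++ (starPairs (cyclesWord cs)) (liftᵗ T) (suc i) ⟩
    stars (cyclesWord cs) (swaps (liftᵗ T) (suc i)) ≡⟨ cong (stars (cyclesWord cs)) (swaps-lift-suc T i) ⟩
    stars (cyclesWord cs) (suc (swaps T i))       ≡⟨ cong (stars (cyclesWord cs) ∘ suc) σi ⟨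
    stars (cyclesWord cs) (suc (cyclesApply cs i)) ≡⟨ stars-cyclesWord cs lengths u i ⟩
    suc i                                         ∎
    where
    σi : cyclesApply cs i ≡ swaps T i
    σi = trans (sym (σ≗cs i)) (trans (σ≗ts i) (prodApply-transpositions τs i))

module _ {n : ℕ} where

  ThreeCycleAt₀ : Permutation′ (suc n) → Set
  ThreeCycleAt₀ t = IsThreeCycle t × Moves zero t

  threeCycle : Fin n → Fin n → Permutation′ (suc n)
  threeCycle a b = permutation (star a ∘ star b) (star b ∘ star a)
    (λ y → trans (cong (star a) (swap-involutive zero (suc b) (star a y))) (swap-involutive zero (suc a) y))
    (λ y → trans (cong (star b) (swap-involutive zero (suc a) (star b y))) (swap-involutive zero (suc b) y))

  threeCycle-isThreeCycle : ∀ {a b} → a ≢ b → ThreeCycleAt₀ (threeCycle a b)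
  threeCycle-isThreeCycle {a} {b} a≢b =
    (zero , suc b , suc a , (λ ()) , b≢a ∘ suc-injective , (λ ()) , zero↦b , b↦a , a↦zero , fixed) ,
    λ zero↦zero → 0≢1+ (trans (sym zero↦zero) zero↦b)
    where
    b≢a : b ≢ a
    b≢a = a≢b ∘ sym
    0≢1+ : ∀ {v : Fin n} → _≢_ {A = Fin (suc n)} zero (suc v)
    0≢1+ ()
    zero↦b : star a (star b zero) ≡ suc b
    zero↦b = trans (cong (star a) (star-zero b)) (star-other b≢a)
    b↦a : star a (star b (suc b)) ≡ suc a
    b↦a = trans (cong (star a) (star-self b)) (star-zero a)
    a↦zero : star a (star b (suc a)) ≡ zero
    a↦zero = trans (cong (star a) (star-other a≢b)) (star-self a)
    fixed : ∀ y → y ≢ zero → y ≢ suc b → y ≢ suc a → star a (star b y) ≡ y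
    fixed zero    y≢0 _ _ = ⊥-elim (y≢0 refl)
    fixed (suc v) _ v≢b v≢a =
      trans (cong (star a) (star-other (v≢b ∘ cong suc))) (star-other (v≢a ∘ cong suc))

  -- Equal neighbours cancel; by the lower bound this never happens for the word used in mainTheorem2.
  pairUp : List (Fin n) → List (Permutation′ (suc n))
  pairUp (a ∷ b ∷ as) with a ≟ᶠ b
  ... | yes _ = pairUp as
  ... | no _  = threeCycle a b ∷ pairUp as
  pairUp _ = []

  pairUp-threeCycles : ∀ as → All ThreeCycleAt₀ (pairUp as)
  pairUp-threeCycles []           = []
  pairUp-threeCycles (_ ∷ [])     = []
  pairUp-threeCycles (a ∷ b ∷ as) with a ≟ᶠ b
  ... | yes _   = pairUp-threeCycles as
  ... | no a≢b  = threeCycle-isThreeCycle a≢b ∷ pairUp-threeCycles as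

  length-pairUp : ∀ as → 2 * length (pairUp as) ≤ length as
  length-pairUp []           = z≤n
  length-pairUp (_ ∷ [])     = z≤n
  length-pairUp (a ∷ b ∷ as) with a ≟ᶠ b
  ... | yes _ = m≤n⇒m≤1+n (m≤n⇒m≤1+n (length-pairUp as))
  ... | no _  =
    subst (_≤ suc (suc (length as))) (sym (*-suc 2 (length (pairUp as)))) (s≤s (s≤s (length-pairUp as)))

  prodApply-pairUp : ∀ as → parity (length as) ≡ 0ℙ → ∀ y → prodApply (pairUp as) y ≡ stars as y
  prodApply-pairUp []           _    y = refl
  prodApply-pairUp (a ∷ b ∷ as) even y with a ≟ᶠ b
  ... | yes refl = trans (prodApply-pairUp as even y) (sym (swap-involutive zero (suc a) (stars as y)))
  ... | no _     = cong (star a ∘ star b) (prodApply-pairUp as even y)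

-- Counting moved points

module _ {a} {A : Set a} where

  sum-map-+ : ∀ (f g : A → ℕ) xs → sum (map (λ x → f x + g x) xs) ≡ sum (map f xs) + sum (map g xs)
  sum-map-+ f g []       = refl
  sum-map-+ f g (x ∷ xs) = begin
    f x + g x + sum (map (λ x → f x + g x) xs)
      ≡⟨ cong (f x + g x +_) (sum-map-+ f g xs) ⟩
    f x + g x + (sum (map f xs) + sum (map g xs))
      ≡⟨ solve 4 (λ a b c d → (a :+ b) :+ (c :+ d) := (a :+ c) :+ (b :+ d)) refl
                 (f x) (g x) (sum (map f xs)) (sum (map g xs)) ⟩
    f x + sum (map f xs) + (g x + sum (map g xs)) ∎
    where open ≡-Reasoning

  sum-map-mono : ∀ {f g : A → ℕ} {xs} → All (λ x → f x ≤ g x) xs → sum (map f xs) ≤ sum (map g xs)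
  sum-map-mono []       = z≤n
  sum-map-mono (h ∷ hs) = +-mono-≤ h (sum-map-mono hs)

  sum-map-++ : ∀ (f : A → ℕ) xs ys → sum (map f (xs ++ ys)) ≡ sum (map f xs) + sum (map f ys)
  sum-map-++ f xs ys = trans (cong sum (map-++ f xs ys)) (sum-++ (map f xs) (map f ys))

  sum-map-concat : ∀ (f : A → ℕ) xss → sum (map f (concat xss)) ≡ sum (map (sum ∘ map f) xss)
  sum-map-concat f []         = refl
  sum-map-concat f (xs ∷ xss) = trans (sum-map-++ f xs (concat xss)) (cong (sum (map f xs) +_) (sum-map-concat f xss))

  sum-map-suc : ∀ (f : A → ℕ) xs → sum (map (suc ∘ f) xs) ≡ sum (map f xs) + length xs
  sum-map-suc f []       = refl
  sum-map-suc f (x ∷ xs) = trans (cong (λ s → 1 + (f x + s)) (sum-map-suc f xs))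
    (solve 3 (λ a b c → con 1 :+ (a :+ (b :+ c)) := (a :+ b) :+ (con 1 :+ c)) refl
           (f x) (sum (map f xs)) (length xs))

  suc-length≤sum : ∀ {f : A → ℕ} {xs x₀} → All (λ x → 1 ≤ f x) xs → x₀ ∈ xs → 2 ≤ f x₀ →
                   suc (length xs) ≤ sum (map f xs)
  suc-length≤sum {f} (_ ∷ hs) (here refl) 2≤fx₀ = +-mono-≤ 2≤fx₀ (length≤sum hs)
    where
    length≤sum : ∀ {xs} → All (λ x → 1 ≤ f x) xs → length xs ≤ sum (map f xs)
    length≤sum []       = z≤n
    length≤sum (h ∷ hs) = +-mono-≤ h (length≤sum hs)
  suc-length≤sum (h ∷ hs) (there x₀∈) 2≤fx₀ = +-mono-≤ h (suc-length≤sum hs x₀∈ 2≤fx₀)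

  splitAtLast : ∀ {q} {Q : A → Set q} → Decidable Q → ∀ xs → Any Q xs →
                ∃[ pre ] ∃[ x ] ∃[ suf ] xs ≡ pre ++ x ∷ suf × Q x × All (¬_ ∘ Q) suf
  splitAtLast Q? (x ∷ xs) any with Any.any? Q? xs
  ... | yes any′ with splitAtLast Q? xs any′
  ...   | pre , y , suf , refl , Qy , none = x ∷ pre , y , suf , refl , Qy , none
  splitAtLast Q? (x ∷ xs) (here Qx)  | no none = [] , x , xs , refl , Qx , ¬Any⇒All¬ xs none
  splitAtLast Q? (x ∷ xs) (there any) | no none = ⊥-elim (none any)

module _ {m : ℕ} where

  moves : Permutation′ m → Fin m → ℕ
  moves t y = if does (t ⟨$⟩ʳ y ≟ᶠ y) then 0 else 1

  timesMoved : List (Permutation′ m) → Fin m → ℕ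
  timesMoved []       y = 0
  timesMoved (t ∷ ts) y = moves t y + timesMoved ts y

  moves≡0⇒fixed : ∀ t y → moves t y ≡ 0 → t ⟨$⟩ʳ y ≡ y
  moves≡0⇒fixed t y with t ⟨$⟩ʳ y ≟ᶠ y
  ... | yes ty≡y = λ _ → ty≡y
  ... | no _     = λ ()

  moves-moved : ∀ t {y} → t ⟨$⟩ʳ y ≢ y → moves t y ≡ 1
  moves-moved t ty≢y = if-no (_ ≟ᶠ _) ty≢y

  timesMoved≡0⇒fixed : ∀ (ts : List (Permutation′ m)) y → timesMoved ts y ≡ 0 → prodApply ts y ≡ y
  timesMoved≡0⇒fixed []       y _  = refl
  timesMoved≡0⇒fixed (t ∷ ts) y eq =
    trans (cong (t ⟨$⟩ʳ_) (timesMoved≡0⇒fixed ts y (m+n≡0⇒n≡0 (moves t y) eq)))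
          (moves≡0⇒fixed t y (m+n≡0⇒m≡0 (moves t y) eq))

  timesMoved-++ : ∀ (ts us : List (Permutation′ m)) y → timesMoved (ts ++ us) y ≡ timesMoved ts y + timesMoved us y
  timesMoved-++ []       us y = refl
  timesMoved-++ (t ∷ ts) us y = trans (cong (moves t y +_) (timesMoved-++ ts us y)) (sym (+-assoc (moves t y) _ _))

  prodApply-++ : ∀ (ts us : List (Permutation′ m)) y → prodApply (ts ++ us) y ≡ prodApply ts (prodApply us y)
  prodApply-++ []       us y = refl
  prodApply-++ (t ∷ ts) us y = cong (t ⟨$⟩ʳ_) (prodApply-++ ts us y)

  ⟨$⟩ʳ-injective : ∀ (t : Permutation′ m) {x y} → t ⟨$⟩ʳ x ≡ t ⟨$⟩ʳ y → x ≡ y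
  ⟨$⟩ʳ-injective t eq = trans (sym (inverseˡ t)) (trans (cong (t ⟨$⟩ˡ_) eq) (inverseˡ t))

  prodPreimage : List (Permutation′ m) → Fin m → Fin m
  prodPreimage []       y = y
  prodPreimage (t ∷ ts) y = prodPreimage ts (t ⟨$⟩ˡ y)

  prodApply-prodPreimage : ∀ (ts : List (Permutation′ m)) y → prodApply ts (prodPreimage ts y) ≡ y
  prodApply-prodPreimage []       y = refl
  prodApply-prodPreimage (t ∷ ts) y = trans (cong (t ⟨$⟩ʳ_) (prodApply-prodPreimage ts (t ⟨$⟩ˡ y))) (inverseʳ t)

  indicator : Fin m → Fin m → ℕ
  indicator p y = if does (y ≟ᶠ p) then 1 else 0

  sum-indicator≤1 : ∀ p {ys} → Unique ys → sum (map (indicator p) ys) ≤ 1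
  sum-indicator≤1 p []                 = z≤n
  sum-indicator≤1 p {y ∷ ys} (y∉ ∷ u) with y ≟ᶠ p
  ... | yes refl = s≤s (≤-reflexive (sum-indicator-∉ ys (λ y∈ → All.lookup y∉ y∈ refl)))
    where
    sum-indicator-∉ : ∀ ys → p ∉ ys → sum (map (indicator p) ys) ≡ 0
    sum-indicator-∉ []       _  = refl
    sum-indicator-∉ (z ∷ ys) p∉ = cong₂ _+_ (if-no (z ≟ᶠ p) (p∉ ∘ here ∘ sym)) (sum-indicator-∉ ys (p∉ ∘ there))
  ... | no _ = sum-indicator≤1 p u

  rotate : ∀ {π : Permutation′ m} → IsThreeCycle π → IsThreeCycle π
  rotate (a , b , c , a≢b , b≢c , a≢c , πa , πb , πc , rest) =
    b , c , a , b≢c , a≢c ∘ sym , a≢b ∘ sym , πb , πc , πa , λ y y≢b y≢c y≢a → rest y y≢a y≢b y≢c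

  threeCycle-support : ∀ {π : Permutation′ m} ((a , b , c , _) : IsThreeCycle π) → ∀ {y} → π ⟨$⟩ʳ y ≢ y →
                       y ≡ a ⊎ y ≡ b ⊎ y ≡ c
  threeCycle-support {π} (a , b , c , _ , _ , _ , _ , _ , _ , rest) {y} moved with y ≟ᶠ a | y ≟ᶠ b | y ≟ᶠ c
  ... | yes y≡a | _       | _       = inj₁ y≡a
  ... | no _    | yes y≡b | _       = inj₂ (inj₁ y≡b)
  ... | no _    | no _    | yes y≡c = inj₂ (inj₂ y≡c)
  ... | no y≢a  | no y≢b  | no y≢c  = ⊥-elim (moved (rest y y≢a y≢b y≢c))

  Orbit : Permutation′ m → Fin m → Fin m → Set
  Orbit π x y = y ≡ x ⊎ y ≡ π ⟨$⟩ʳ x ⊎ y ≡ π ⟨$⟩ʳ (π ⟨$⟩ʳ x)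

  threeCycle-orbit-first : ∀ {π : Permutation′ m} (h@(a , _) : IsThreeCycle π) → ∀ {y} →
                           π ⟨$⟩ʳ y ≢ y → Orbit π a y
  threeCycle-orbit-first {π} h@(a , b , c , _ , _ , _ , πa , πb , _) moved with threeCycle-support {π} h moved
  ... | inj₁ y≡a        = inj₁ y≡a
  ... | inj₂ (inj₁ y≡b) = inj₂ (inj₁ (trans y≡b (sym πa)))
  ... | inj₂ (inj₂ y≡c) = inj₂ (inj₂ (trans y≡c (sym (trans (cong (π ⟨$⟩ʳ_) πa) πb))))

  threeCycle-orbit : ∀ {π : Permutation′ m} → IsThreeCycle π → ∀ {x y} →
                     π ⟨$⟩ʳ x ≢ x → π ⟨$⟩ʳ y ≢ y → Orbit π x y
  threeCycle-orbit {π} h x-moved y-moved with threeCycle-support {π} h x-moved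
  ... | inj₁ refl        = threeCycle-orbit-first {π} h y-moved
  ... | inj₂ (inj₁ refl) = threeCycle-orbit-first {π} (rotate {π} h) y-moved
  ... | inj₂ (inj₂ refl) = threeCycle-orbit-first {π} (rotate {π} (rotate {π} h)) y-moved

module _ {n : ℕ} where

  moves-threeCycle : ∀ {t : Permutation′ (suc n)} → ThreeCycleAt₀ t → ∀ {y} → y ≢ zero →
                     moves t y ≤ indicator (t ⟨$⟩ʳ zero) y + indicator (t ⟨$⟩ʳ (t ⟨$⟩ʳ zero)) y
  moves-threeCycle {t} (h , 0-moved) {y} y≢0 with t ⟨$⟩ʳ y ≟ᶠ y
  ... | yes _     = z≤n
  ... | no moved with threeCycle-orbit {π = t} h 0-moved moved
  ...   | inj₁ y≡0        = ⊥-elim (y≢0 y≡0)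
  ...   | inj₂ (inj₁ y≡t0) =
    subst (λ k → 1 ≤ k + indicator (t ⟨$⟩ʳ (t ⟨$⟩ʳ zero)) y) (sym (if-yes (y ≟ᶠ _) y≡t0)) (s≤s z≤n)
  ...   | inj₂ (inj₂ y≡tt0) =
    subst (λ k → 1 ≤ indicator (t ⟨$⟩ʳ zero) y + k) (sym (if-yes (y ≟ᶠ _) y≡tt0)) (m≤n⇒m≤o+n _ (s≤s z≤n))

  sum-moves-threeCycle : ∀ {t : Permutation′ (suc n)} → ThreeCycleAt₀ t → ∀ {ys} → Unique ys → zero ∉ ys → sum (map (moves t) ys) ≤ 2
  sum-moves-threeCycle {t} h {ys} u 0∉ = begin
    sum (map (moves t) ys)
      ≤⟨ sum-map-mono (All.tabulate (λ y∈ → moves-threeCycle {t} h (λ y≡0 → 0∉ (subst (_∈ ys) y≡0 y∈)))) ⟩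
    sum (map (λ y → indicator p y + indicator q y) ys)
      ≡⟨ sum-map-+ (indicator p) (indicator q) ys ⟩
    sum (map (indicator p) ys) + sum (map (indicator q) ys)
      ≤⟨ +-mono-≤ (sum-indicator≤1 p u) (sum-indicator≤1 q u) ⟩
    2 ∎
    where
    open ≤-Reasoning
    p = t ⟨$⟩ʳ zero
    q = t ⟨$⟩ʳ p

  sum-timesMoved : ∀ {ts : List (Permutation′ (suc n))} → All ThreeCycleAt₀ ts → ∀ {ys} → Unique ys → zero ∉ ys →
                   sum (map (timesMoved ts) ys) ≤ 2 * length ts
  sum-timesMoved {[]}     []       {ys} _ _  = ≤-reflexive (sum-map-zero ys)
    where
    sum-map-zero : ∀ ys → sum (map (timesMoved []) ys) ≡ 0
    sum-map-zero []       = refl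
    sum-map-zero (_ ∷ ys) = sum-map-zero ys
  sum-timesMoved {t ∷ ts} (h ∷ hs) {ys} u 0∉ = begin
    sum (map (timesMoved (t ∷ ts)) ys)
      ≡⟨ sum-map-+ (moves t) (timesMoved ts) ys ⟩
    sum (map (moves t) ys) + sum (map (timesMoved ts) ys)
      ≤⟨ +-mono-≤ (sum-moves-threeCycle {t} h u 0∉) (sum-timesMoved hs u 0∉) ⟩
    2 + 2 * length ts
      ≡⟨ *-suc 2 (length ts) ⟨
    2 * length (t ∷ ts) ∎
    where open ≤-Reasoning

module _ {m : ℕ} (C : List (Fin m)) where

  Touches : Permutation′ m → Set
  Touches t = Any (λ y → t ⟨$⟩ʳ y ≢ y) C

  touches? : Decidable Touches
  touches? t = Any.any? (λ y → ¬? (t ⟨$⟩ʳ y ≟ᶠ y)) C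

  Enters : Permutation′ m → Set
  Enters t = ∃[ p ] ∃[ y ] p ∉ C × y ∈ C × t ⟨$⟩ʳ p ≡ y

  prodApply-untouched : ∀ {ts} → All (¬_ ∘ Touches) ts → ∀ {v} → v ∈ C → prodApply ts v ≡ v
  prodApply-untouched []                  v∈ = refl
  prodApply-untouched {t ∷ ts} (¬t ∷ ¬ts) {v} v∈ with t ⟨$⟩ʳ v ≟ᶠ v
  ... | yes tv≡v = trans (cong (t ⟨$⟩ʳ_) (prodApply-untouched ¬ts v∈)) tv≡v
  ... | no tv≢v  = ⊥-elim (¬t (Any.map (λ { refl → tv≢v }) v∈))

  some-factor-touches : ∀ ts {y} → y ∈ C → prodApply ts y ≢ y → Any Touches ts
  some-factor-touches ts y∈ moved with Any.any? touches? ts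
  ... | yes any = any
  ... | no none = ⊥-elim (moved (prodApply-untouched (¬Any⇒All¬ ts none) y∈))

  -- The rightmost factor touching C carries a point outside C onto some y ∈ C; as C is closed
  -- under preimages of the product, a factor further left must move y again.
  moved-twice : ∀ ts → (∀ v → prodApply ts v ∈ C → v ∈ C) → All (λ t → Touches t → Enters t) ts →
                Any Touches ts → ∃[ y ] y ∈ C × 2 ≤ timesMoved ts y
  moved-twice ts closed enters touched with splitAtLast touches? ts touched
  ... | pre , t , suf , refl , t-touches , suf-untouched
      with All.lookup enters (∈-++⁺ʳ pre (here refl)) t-touches
  ...   | p , y , p∉ , y∈ , tp≡y =
    y , y∈ , subst (2 ≤_) (sym (timesMoved-++ pre (t ∷ suf) y)) (+-mono-≤ pre-moves t-moves)
    where
    t-moves : 1 ≤ timesMoved (t ∷ suf) y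
    t-moves = subst (λ k → 1 ≤ k + timesMoved suf y) (sym (moves-moved t ty≢y)) (s≤s z≤n)
      where
      ty≢y : t ⟨$⟩ʳ y ≢ y
      ty≢y ty≡y = p∉ (subst (_∈ C) (sym (⟨$⟩ʳ-injective t (trans tp≡y (sym ty≡y)))) y∈)
    v = prodPreimage suf p
    v∉ : v ∉ C
    v∉ v∈ = p∉ (subst (_∈ C) (trans (sym (prodApply-untouched suf-untouched v∈)) (prodApply-prodPreimage suf p)) v∈)
    pre-moves : 1 ≤ timesMoved pre y
    pre-moves = n≢0⇒n>0 λ pre-fixes → v∉ (closed v (subst (_∈ C) (sym (begin
      prodApply (pre ++ t ∷ suf) v
        ≡⟨ prodApply-++ pre (t ∷ suf) v ⟩
      prodApply pre (t ⟨$⟩ʳ prodApply suf v)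
        ≡⟨ cong (prodApply pre ∘ (t ⟨$⟩ʳ_)) (prodApply-prodPreimage suf p) ⟩
      prodApply pre (t ⟨$⟩ʳ p)
        ≡⟨ cong (prodApply pre) tp≡y ⟩
      prodApply pre y
        ≡⟨ timesMoved≡0⇒fixed pre y pre-fixes ⟩
      y ∎)) y∈))
      where open ≡-Reasoning

module _ {n : ℕ} {C : List (Fin (suc n))} (0∉C : zero ∉ C) where

  open import Data.List.Membership.DecPropositional (_≟ᶠ_ {suc n}) using (_∈?_)

  threeCycle-enters : ∀ {t : Permutation′ (suc n)} → ThreeCycleAt₀ t → Touches C t → Enters C t
  threeCycle-enters {t} (h , 0-moved) touches with find touches | t ⟨$⟩ʳ zero ∈? C
  ... | _ , _  , _       | yes t0∈ = zero , t ⟨$⟩ʳ zero , 0∉C , t0∈ , refl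
  ... | z , z∈ , z-moved | no t0∉ with threeCycle-orbit {π = t} h 0-moved z-moved
  ...   | inj₁ refl        = ⊥-elim (0∉C z∈)
  ...   | inj₂ (inj₁ refl) = ⊥-elim (t0∉ z∈)
  ...   | inj₂ (inj₂ z≡)   = t ⟨$⟩ʳ zero , z , t0∉ , z∈ , sym z≡

  block-bound : ∀ {ts : List (Permutation′ (suc n))} → All ThreeCycleAt₀ ts → ∀ {y₀} → y₀ ∈ C → (∀ {y} → y ∈ C → prodApply ts y ≢ y) →
                (∀ v → prodApply ts v ∈ C → v ∈ C) → suc (length C) ≤ sum (map (timesMoved ts) C)
  block-bound {ts} hs y₀∈ moved closed
    with moved-twice C ts closed (All.map (λ {t} → threeCycle-enters {t}) hs)
                     (some-factor-touches C ts y₀∈ (moved y₀∈))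
  ... | y , y∈ , twice =
    suc-length≤sum (All.tabulate (λ y∈ → n≢0⇒n>0 (moved y∈ ∘ timesMoved≡0⇒fixed ts _))) y∈ twice

module _ {n : ℕ} {σ : Permutation′ n} {cs : List (List (Fin n))}
         (lengths : All (λ c → 2 ≤ length c) cs) (u : Unique (concat cs)) (σ≗cs : ∀ y → σ ⟨$⟩ʳ y ≡ cyclesApply cs y)
         {ts : List (Permutation′ (suc n))} (hs : All ThreeCycleAt₀ ts)
         (ts≗σ⁻¹ : ∀ y → prodApply ts y ≡ lift₀ (flip σ) ⟨$⟩ʳ y) where

  private
    0∉map-suc : ∀ {ys : List (Fin n)} → Fin.zero ∉ map Fin.suc ys
    0∉map-suc 0∈ with ∈-map⁻ Fin.suc 0∈
    ... | _ , _ , ()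

  cycle-bound : ∀ {c} → c ∈ cs → suc (length c) ≤ sum (map (timesMoved ts ∘ Fin.suc) c)
  cycle-bound {c} c∈ = subst₂ (λ k s → suc k ≤ s) (length-map Fin.suc c) (sym (cong sum (map-∘ c)))
    (block-bound 0∉map-suc hs (∈-map⁺ Fin.suc (proj₂ (head-∈ c 2≤∣c∣))) moved closed)
    where
    2≤∣c∣ = All.lookup lengths c∈
    σ≗c : ∀ {w} → w ∈ c → σ ⟨$⟩ʳ w ≡ cycleFun c w
    σ≗c w∈ = trans (σ≗cs _) (cyclesApply-∈ cs lengths u c∈ w∈)
    c-cycle : ∀ {w} → w ∈ c → cycleFun c w ∈ c × cycleFun c w ≢ w
    c-cycle = cycleFun-∈ c 2≤∣c∣ (unique-∈-concat cs u c∈)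
    head-∈ : ∀ (d : List (Fin n)) → 2 ≤ length d → Σ (Fin n) (_∈ d)
    head-∈ (w ∷ _) _ = w , here refl
    moved : ∀ {y} → y ∈ map Fin.suc c → prodApply ts y ≢ y
    moved y∈ eq with ∈-map⁻ Fin.suc y∈
    ... | w , w∈ , refl = proj₂ (c-cycle w∈) (begin
      cycleFun c w       ≡⟨ σ≗c w∈ ⟨
      σ ⟨$⟩ʳ w           ≡⟨ cong (σ ⟨$⟩ʳ_) (suc-injective (trans (sym (ts≗σ⁻¹ (suc w))) eq)) ⟨
      σ ⟨$⟩ʳ (σ ⟨$⟩ˡ w)  ≡⟨ inverseʳ σ ⟩
      w                  ∎)
      where open ≡-Reasoning
    closed : ∀ v → prodApply ts v ∈ map Fin.suc c → v ∈ map Fin.suc c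
    closed v ρv∈ rewrite ts≗σ⁻¹ v with v
    ... | zero  = ⊥-elim (0∉map-suc ρv∈)
    ... | suc v′ with ∈-map⁻ Fin.suc ρv∈
    ...   | w , w∈ , σ⁻¹v′≡w = subst (_∈ map Fin.suc c) (cong suc σw≡v′) (∈-map⁺ Fin.suc (proj₁ (c-cycle w∈)))
      where
      σw≡v′ : cycleFun c w ≡ v′
      σw≡v′ = trans (sym (σ≗c w∈)) (trans (cong (σ ⟨$⟩ʳ_) (sym (suc-injective σ⁻¹v′≡w))) (inverseʳ σ))

  threeCycles-lower-bound : sum (map length cs) + length cs ≤ 2 * length ts
  threeCycles-lower-bound = begin
    sum (map length cs) + length cs
      ≡⟨ sum-map-suc length cs ⟨
    sum (map (suc ∘ length) cs)
      ≤⟨ sum-map-mono (All.tabulate cycle-bound) ⟩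
    sum (map (sum ∘ map (timesMoved ts ∘ Fin.suc)) cs)
      ≡⟨ sum-map-concat (timesMoved ts ∘ Fin.suc) cs ⟨
    sum (map (timesMoved ts ∘ Fin.suc) (concat cs))
      ≡⟨ cong sum (map-∘ (concat cs)) ⟩
    sum (map (timesMoved ts) (map Fin.suc (concat cs)))
      ≤⟨ sum-timesMoved hs (map⁺ suc-injective u) 0∉map-suc ⟩
    2 * length ts ∎
    where open ≤-Reasoning

mainTheorem2 : (n : ℕ) (σ : Permutation′ n) → IsEven σ →
    (cs : List (List (Fin n))) →
    All (λ c → 2 ≤ length c) cs →
    Unique (concat cs) →
    sum (map length cs) ≡ n →
    (∀ y → σ ⟨$⟩ʳ y ≡ cyclesApply cs y) →
    (Σ (List (Permutation′ (suc n))) λ ts →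
        All (λ t → IsThreeCycle t × Moves zero t) ts ×
        2 * length ts ≡ n + length cs ×
        (∀ y → prodApply ts y ≡ lift₀ (flip σ) ⟨$⟩ʳ y))
    × ((ts : List (Permutation′ (suc n))) →
        All (λ t → IsThreeCycle t × Moves zero t) ts →
        (∀ y → prodApply ts y ≡ lift₀ (flip σ) ⟨$⟩ʳ y) →
        n + length cs ≤ 2 * length ts)
mainTheorem2 n σ σ-even cs lengths u ∑lengths≡n σ≗cs =
  (ts , threeCycles , ≤-antisym upper (lower ts threeCycles ts≗σ⁻¹) , ts≗σ⁻¹) , lower
  where
  word = cyclesWord cs
  ts = pairUp word
  threeCycles = pairUp-threeCycles {n} word
  ts≗σ⁻¹ : ∀ y → prodApply ts y ≡ lift₀ (flip σ) ⟨$⟩ʳ y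
  ts≗σ⁻¹ y = trans (prodApply-pairUp word (parity-cyclesWord {σ = σ} σ-even cs lengths u σ≗cs) y)
                   (stars-cyclesWord-σ⁻¹ cs lengths u σ≗cs y)
  upper : 2 * length ts ≤ n + length cs
  upper = ≤-trans (length-pairUp word)
                  (≤-reflexive (trans (length-cyclesWord cs lengths) (cong (_+ length cs) ∑lengths≡n)))
  lower : ∀ ts → All ThreeCycleAt₀ ts → (∀ y → prodApply ts y ≡ lift₀ (flip σ) ⟨$⟩ʳ y) →
          n + length cs ≤ 2 * length ts
  lower ts hs ts≗σ⁻¹ = subst (λ k → k + length cs ≤ 2 * length ts) ∑lengths≡n
                             (threeCycles-lower-bound lengths u σ≗cs hs ts≗σ⁻¹)
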